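{- Let $D$ be a digraph having an out-branching, let $U$ be a vertex cover of $D$ that contains the vertex of in-degree $0$ of $D$ if such a vertex exists, let $W=V(D)\setminus U$, and let $B$ be the bipartite graph with $V(B)=U'\cup W$, where $U'=N^-(W)\cup(U\times U)$, and $E(B)=\{\{xy,w\}: xy\in U\times U,\ w\in W,\ (x,w)\in A(D),\ (w,y)\in A(D)\}\cup\{\{x,w\}: x\in U,\ w\in W,\ (x,w)\in A(D)\}$. If $B$ contains a crown $(H,C=C_m\cup C_u)$ with $C\subseteq W$ and $C_u\neq\emptyset$, then the internal number of $D$ equals the internal number of $D-C_u$.
   Context: Digraphs are finite, without loops or parallel arcs. An out-branching of $D$ is a spanning subgraph that is an oriented tree with exactly one vertex of in-degree zero; its vertices of out-degree zero are leaves, the others internal. The internal number of a digraph is the largest number of internal vertices of an out-branching of it. A vertex cover of $D$ is a vertex cover of its underlying undirected graph. $N^-(W)$ is the set of in-neighbours of vertices of $W$. Elements of $U\times U$ are treated as new vertices ("pair vertices") $xy$. A crown in a graph $G$ is a pair $(H,C)$ of disjoint vertex sets with $H=N(C)$ (the set of neighbours of vertices of $C$), $C=C_m\cup C_u$ an independent set (with $C_m,C_u$ disjoint), and a perfect matching between $C_m$ and $H$. -}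

module Defs where

open import Data.Nat using (ℕ; zero; suc; _+_; _≤_)
open import Data.Fin using (Fin; zero; suc)
open import Data.Bool using (Bool; true; false; _∧_; _∨_; not; if_then_else_)
open import Data.Sum using (_⊎_; inj₁; inj₂)
open import Data.Product using (Σ; ∃; _×_; _,_)
open import Data.Empty using (⊥)
open import Relation.Binary.PropositionalEquality using (_≡_; _≢_)
open import Relation.Nullary using (¬_)
open import Function using (_∘_)

-- A digraph is given by n : ℕ, a vertex set  V : Fin n → Bool  (a subset of
-- Fin n) and an arc relation  A : Fin n → Fin n → Bool  (A u v = true means
-- (u,v) is an arc).  Well-formedness (arcs inside V, no loops) is assumed
-- explicitly where needed.  Having a vertex *subset* lets us form D - X
-- without re-indexing.

count : ∀ {n} → (Fin n → Bool) → ℕ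
count {zero} f = 0
count {suc n} f = (if f zero then 1 else 0) + count (f ∘ suc)

anyB : ∀ {n} → (Fin n → Bool) → Bool
anyB {zero} f = false
anyB {suc n} f = f zero ∨ anyB (f ∘ suc)

data Reach {n : ℕ} (S : Fin n → Fin n → Bool) (r : Fin n) : Fin n → Set where
  here : Reach S r r
  step : ∀ {u v} → Reach S r u → S u v ≡ true → Reach S r v

-- An out-branching of (V , A): a spanning subdigraph S ⊆ A whose underlying
-- graph is a tree with exactly one vertex (the root) of in-degree 0:
-- root has in-degree 0, every other vertex in-degree 1, all vertices
-- reachable from the root (these conditions say exactly that S is a
-- spanning oriented tree with a unique source).
record OutBranching (n : ℕ) (V : Fin n → Bool) (A : Fin n → Fin n → Bool) : Set where
  field
    S          : Fin n → Fin n → Bool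
    root       : Fin n
    S⊆A        : ∀ u v → S u v ≡ true → A u v ≡ true
    root∈V     : V root ≡ true
    root-indeg : count (λ u → S u root) ≡ 0
    indeg-one  : ∀ v → V v ≡ true → v ≢ root → count (λ u → S u v) ≡ 1
    spanning   : ∀ v → V v ≡ true → Reach S root v

internals : ∀ {n V A} → OutBranching n V A → ℕ
internals {n} {V} T = count (λ v → V v ∧ anyB (λ w → OutBranching.S T v w))

HasInternalNumber : (n : ℕ) → (Fin n → Bool) → (Fin n → Fin n → Bool) → ℕ → Set
HasInternalNumber n V A k =
  (Σ (OutBranching n V A) λ T → internals T ≡ k) ×
  (∀ (T : OutBranching n V A) → internals T ≤ k)

IsVertexCover : ∀ {n} → (Fin n → Bool) → (Fin n → Fin n → Bool) → (Fin n → Bool) → Set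
IsVertexCover V A U =
  (∀ v → U v ≡ true → V v ≡ true) ×
  (∀ u v → A u v ≡ true → (U u ≡ true) ⊎ (U v ≡ true))

-- The bipartite graph B.
-- Vertices: inj₁ v  (an original vertex; element of W or of N⁻(W)),
--           inj₂ (x , y)  (the new pair vertex xy, x,y ∈ U).

BV : ℕ → Set
BV n = Fin n ⊎ (Fin n × Fin n)

Wset : ∀ {n} → (Fin n → Bool) → (Fin n → Bool) → Fin n → Bool
Wset V U v = V v ∧ not (U v)

inB : ∀ {n} → (Fin n → Bool) → (Fin n → Fin n → Bool) → (Fin n → Bool) → BV n → Set
inB V A U (inj₁ v) = (Wset V U v ≡ true) ⊎ (∃ λ w → Wset V U w ≡ true × A v w ≡ true)
inB V A U (inj₂ (x , y)) = (U x ≡ true) × (U y ≡ true)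

-- oriented version of the edges of B (pair/single vertex first, W-vertex second)
BE' : ∀ {n} → (Fin n → Bool) → (Fin n → Fin n → Bool) → (Fin n → Bool) → BV n → BV n → Set
BE' V A U (inj₂ (x , y)) (inj₁ w) =
  (U x ≡ true) × (U y ≡ true) × (Wset V U w ≡ true) × (A x w ≡ true) × (A w y ≡ true)
BE' V A U (inj₁ x) (inj₁ w) = (U x ≡ true) × (Wset V U w ≡ true) × (A x w ≡ true)
BE' V A U _ (inj₂ _) = ⊥

BE : ∀ {n} → (Fin n → Bool) → (Fin n → Fin n → Bool) → (Fin n → Bool) → BV n → BV n → Set
BE V A U a b = BE' V A U a b ⊎ BE' V A U b a

record IsCrown {X : Set} (inV : X → Set) (E : X → X → Set) (H Cm Cu : X → Bool) : Set where
  field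
    H⊆V        : ∀ x → H x ≡ true → inV x
    C⊆V        : ∀ x → (Cm x ∨ Cu x) ≡ true → inV x
    disj-H-C   : ∀ x → H x ≡ true → (Cm x ∨ Cu x) ≡ true → ⊥
    disj-Cm-Cu : ∀ x → Cm x ≡ true → Cu x ≡ true → ⊥
    H⊆N[C]     : ∀ x → H x ≡ true → inV x × (∃ λ c → (Cm c ∨ Cu c) ≡ true × E c x)
    N[C]⊆H     : ∀ x → inV x → (∃ λ c → (Cm c ∨ Cu c) ≡ true × E c x) → H x ≡ true
    C-indep    : ∀ x y → (Cm x ∨ Cu x) ≡ true → (Cm y ∨ Cu y) ≡ true → ¬ E x y
    match      : X → X
    match-H    : ∀ c → Cm c ≡ true → H (match c) ≡ true
    match-E    : ∀ c → Cm c ≡ true → E c (match c)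
    match-inj  : ∀ c c' → Cm c ≡ true → Cm c' ≡ true → match c ≡ match c' → c ≡ c'
    match-surj : ∀ h → H h ≡ true → ∃ λ c → Cm c ≡ true × match c ≡ h

-- D - Cu  (Cu given as a subset of V(B); removes the original vertices w
-- with inj₁ w ∈ Cu)
delV : ∀ {n} → (Fin n → Bool) → (BV n → Bool) → Fin n → Bool
delV V Cu v = V v ∧ not (Cu (inj₁ v))

delA : ∀ {n} → (Fin n → Fin n → Bool) → (BV n → Bool) → Fin n → Fin n → Bool
delA A Cu u v = A u v ∧ not (Cu (inj₁ u)) ∧ not (Cu (inj₁ v))

-- Any out-branching of D − Cu extends to one of D with at least as many internal vertices:
-- hang each vertex of Cu, as a leaf, below an in-neighbour (which lies in U, hence survives
-- the deletion).  Conversely, an out-branching T of D is rebuilt on D − Cu with the matching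
-- of the crown: the vertices of C ⊆ W are detached, each c ∈ Cm is hung below its partner,
-- and whenever a vertex w ∈ C with parent x had a child y in T, the pair xy lies in H = N(C),
-- so its partner takes over the child y.  An internal vertex u ∉ C of T stays internal (if
-- its children lie in C then u ∈ H, and the partner of u hangs below u), and the internal
-- vertices of C inject, through their children, into internal vertices of Cm.  A root of T
-- lying in C is handled by giving it an in-neighbour as fictitious parent.

module Submission where

open import Defs
open import Data.Nat using (ℕ; zero; suc; _+_; _≤_; z≤n; s≤s)
open import Data.Nat.Properties using (≤-trans; ≤-antisym; suc-injective; +-suc; m+n≡0⇒m≡0; m+n≡0⇒n≡0)
open import Data.Fin using (Fin; zero; suc; _≟_)
open import Data.Fin.Properties using (any?; 0≢1+n)
import Data.Fin.Properties as Fin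
open import Data.Bool using (Bool; true; false; _∨_; _∧_; not; if_then_else_)
open import Data.Bool.Properties using (∧-identityʳ; ∨-conicalʳ; ¬-not) renaming (_≟_ to _≟ᵇ_)
open import Data.Sum using (_⊎_; inj₁; inj₂)
open import Data.Sum.Properties using (inj₁-injective)
open import Data.Product using (∃; _×_; _,_; proj₁; proj₂)
open import Data.Empty using (⊥; ⊥-elim)
open import Relation.Nullary using (yes; no; does)
open import Relation.Nullary.Decidable using (dec-true; dec-false)
open import Relation.Binary.PropositionalEquality using (_≡_; refl; sym; trans; cong; cong₂; subst; _≢_)
open import Function using (_∘_)

true⇒¬false : ∀ {b} → b ≡ true → b ≢ false
true⇒¬false refl ()

bool-cases : ∀ {ℓ} {X : Set ℓ} (b : Bool) → (b ≡ true → X) → (b ≡ false → X) → X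
bool-cases true  t _ = t refl
bool-cases false _ f = f refl

∨-true⁻ : ∀ {a b} → a ∨ b ≡ true → a ≡ true ⊎ b ≡ true
∨-true⁻ {true}  _ = inj₁ refl
∨-true⁻ {false} p = inj₂ p

∨-trueˡ : ∀ {a b} → a ≡ true → a ∨ b ≡ true
∨-trueˡ refl = refl

∨-trueʳ : ∀ {a b} → b ≡ true → a ∨ b ≡ true
∨-trueʳ {true}  _ = refl
∨-trueʳ {false} p = p

∨-true-falseʳ : ∀ {a b} → a ∨ b ≡ true → b ≡ false → a ≡ true
∨-true-falseʳ {true}  _ _ = refl
∨-true-falseʳ {false} p q = ⊥-elim (true⇒¬false p q)

∧-true⁻ : ∀ {a b} → a ∧ b ≡ true → a ≡ true × b ≡ true
∧-true⁻ {true} p = refl , p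

∧-true⁺ : ∀ {a b} → a ≡ true → b ≡ true → a ∧ b ≡ true
∧-true⁺ refl p = p

not-false⁺ : ∀ {a} → a ≡ false → not a ≡ true
not-false⁺ refl = refl

not-true⁻ : ∀ {a} → not a ≡ true → a ≡ false
not-true⁻ {false} _ = refl

_==_ : ∀ {n} → Fin n → Fin n → Bool
a == b = does (a ≟ b)

==⇒≡ : ∀ {n} {a b : Fin n} → (a == b) ≡ true → a ≡ b
==⇒≡ {a = a} {b} p with a ≟ b
... | yes a≡b = a≡b

≡⇒== : ∀ {n} {a b : Fin n} → a ≡ b → (a == b) ≡ true
≡⇒== {a = a} {b} = dec-true (a ≟ b)

≢⇒==false : ∀ {n} {a b : Fin n} → a ≢ b → (a == b) ≡ false
≢⇒==false {a = a} {b} = dec-false (a ≟ b)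

==false⇒≢ : ∀ {n} {a b : Fin n} → (a == b) ≡ false → a ≢ b
==false⇒≢ p a≡b = true⇒¬false (≡⇒== a≡b) p

indicator : Bool → ℕ
indicator b = if b then 1 else 0

count-cong : ∀ {n} {f g : Fin n → Bool} → (∀ i → f i ≡ g i) → count f ≡ count g
count-cong {zero}  _   = refl
count-cong {suc n} f≗g = cong₂ _+_ (cong indicator (f≗g zero)) (count-cong (f≗g ∘ suc))

count≡0 : ∀ {n} (f : Fin n → Bool) → (∀ i → f i ≢ true) → count f ≡ 0
count≡0 {zero}  f none = refl
count≡0 {suc n} f none = bool-cases (f zero) (λ e → ⊥-elim (none zero e))
  (λ e → cong₂ _+_ (cong indicator e) (count≡0 (f ∘ suc) (none ∘ suc)))

count≡0⁻ : ∀ {n} (f : Fin n → Bool) → count f ≡ 0 → ∀ i → f i ≢ true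
count≡0⁻ {suc n} f c zero    p with () ← subst (λ b → indicator b ≡ 0) p (m+n≡0⇒m≡0 (indicator (f zero)) c)
count≡0⁻ {suc n} f c (suc i) p = count≡0⁻ (f ∘ suc) (m+n≡0⇒n≡0 (indicator (f zero)) c) i p

count≡1 : ∀ {n} (f : Fin n → Bool) a → f a ≡ true → (∀ b → f b ≡ true → b ≡ a) → count f ≡ 1
count≡1 {suc n} f zero fa unique =
  cong₂ _+_ (cong indicator fa) (count≡0 (f ∘ suc) (λ i p → 0≢1+n (sym (unique (suc i) p))))
count≡1 {suc n} f (suc a) fa unique = bool-cases (f zero) (λ e → ⊥-elim (0≢1+n (unique zero e)))
  (λ e → cong₂ _+_ (cong indicator e) (count≡1 (f ∘ suc) a fa (λ b p → Fin.suc-injective (unique (suc b) p))))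

count-head≡1 : ∀ {n} (f : Fin (suc n) → Bool) → count f ≡ 1 → f zero ≡ true → count (f ∘ suc) ≡ 0
count-head≡1 f c e = suc-injective (subst (λ b → indicator b + count (f ∘ suc) ≡ 1) e c)

count≡1⇒unique : ∀ {n} (f : Fin n → Bool) → count f ≡ 1 → ∀ a b → f a ≡ true → f b ≡ true → a ≡ b
count≡1⇒unique {suc n} f c zero    zero    _  _  = refl
count≡1⇒unique {suc n} f c zero    (suc b) fa fb = ⊥-elim (count≡0⁻ (f ∘ suc) (count-head≡1 f c fa) b fb)
count≡1⇒unique {suc n} f c (suc a) zero    fa fb = ⊥-elim (count≡0⁻ (f ∘ suc) (count-head≡1 f c fb) a fa)
count≡1⇒unique {suc n} f c (suc a) (suc b) fa fb = bool-cases (f zero)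
  (λ e → ⊥-elim (count≡0⁻ (f ∘ suc) (count-head≡1 f c e) a fa))
  (λ e → cong suc (count≡1⇒unique (f ∘ suc) (subst (λ b → indicator b + count (f ∘ suc) ≡ 1) e c) a b fa fb))

count≡suc⇒witness : ∀ {n} (f : Fin n → Bool) {m} → count f ≡ suc m → ∃ λ i → f i ≡ true
count≡suc⇒witness {suc n} f {m} c = bool-cases (f zero) (λ e → zero , e)
  (λ e → let (i , fi) = count≡suc⇒witness (f ∘ suc) (subst (λ b → indicator b + count (f ∘ suc) ≡ suc m) e c)
         in suc i , fi)

count-remove : ∀ {n} (f : Fin n → Bool) j → f j ≡ true → count f ≡ suc (count (λ i → f i ∧ not (i == j)))
count-remove {suc n} f zero fj rewrite fj = cong suc (count-cong (λ i → sym (∧-identityʳ (f (suc i)))))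
count-remove {suc n} f (suc j) fj =
  trans (cong (indicator (f zero) +_) (count-remove (f ∘ suc) j fj))
  (trans (+-suc (indicator (f zero)) _)
         (cong (λ b → suc (indicator b + count (λ i → f (suc i) ∧ not (i == j)))) (sym (∧-identityʳ (f zero)))))

count-≤-injection : ∀ {m n} (P : Fin m → Bool) (Q : Fin n → Bool) (R : Fin m → Fin n → Set)
  → (∀ i → P i ≡ true → ∃ λ j → Q j ≡ true × R i j)
  → (∀ i i' j → R i j → R i' j → i ≡ i')
  → count P ≤ count Q
count-≤-injection P Q R total injective = go (count P) P Q refl total
  where
  go : ∀ k P Q → count P ≡ k → (∀ i → P i ≡ true → ∃ λ j → Q j ≡ true × R i j) → k ≤ count Q
  go zero    _ _ _ _ = z≤n
  go (suc k) P Q c total with count≡suc⇒witness P c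
  ... | i , Pi with total i Pi
  ... | j , Qj , Rij = subst (suc k ≤_) (sym (count-remove Q j Qj)) (s≤s (go k P′ Q′ c′ total′))
    where
    P′ Q′ : _
    P′ i′ = P i′ ∧ not (i′ == i)
    Q′ j′ = Q j′ ∧ not (j′ == j)
    c′ : count P′ ≡ k
    c′ = suc-injective (trans (sym (count-remove P i Pi)) c)
    total′ : ∀ i′ → P′ i′ ≡ true → ∃ λ j′ → Q′ j′ ≡ true × R i′ j′
    total′ i′ p with ∧-true⁻ {P i′} p
    ... | Pi′ , i′≢i with total i′ Pi′
    ... | j′ , Qj′ , Ri′j′ =
      j′ , ∧-true⁺ Qj′ (not-false⁺ (≢⇒==false λ j′≡j →
             ==false⇒≢ (not-true⁻ i′≢i) (injective i′ i j (subst (R i′) j′≡j Ri′j′) Rij))) , Ri′j′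

anyB-intro : ∀ {n} {f : Fin n → Bool} i → f i ≡ true → anyB f ≡ true
anyB-intro zero    p = ∨-trueˡ p
anyB-intro (suc i) p = ∨-trueʳ (anyB-intro i p)

anyB-witness : ∀ {n} (f : Fin n → Bool) → anyB f ≡ true → ∃ λ i → f i ≡ true
anyB-witness {suc n} f p with ∨-true⁻ {f zero} p
... | inj₁ q = zero , q
... | inj₂ q = let (i , fi) = anyB-witness (f ∘ suc) q in suc i , fi

choose : ∀ {n} → (Fin n → Bool) → Fin n → Fin n
choose f default with any? (λ i → f i ≟ᵇ true)
... | yes (i , _) = i
... | no _        = default

choose-spec : ∀ {n} (f : Fin n → Bool) default → (∃ λ i → f i ≡ true) → f (choose f default) ≡ true
choose-spec f default w with any? (λ i → f i ≟ᵇ true)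
... | yes (_ , fi) = fi
... | no ¬w        = ⊥-elim (¬w w)

module _ {n : ℕ} {S : Fin n → Fin n → Bool} {z : Fin n} where

  Reach-ind : (P : Fin n → Set) → P z → (∀ u v → P u → S u v ≡ true → P v) → ∀ {v} → Reach S z v → P v
  Reach-ind P Pz step′ here         = Pz
  Reach-ind P Pz step′ (step p Suv) = step′ _ _ (Reach-ind P Pz step′ p) Suv

  Reach-mono : ∀ {S′} → (∀ u v → S u v ≡ true → S′ u v ≡ true) → ∀ {v} → Reach S z v → Reach S′ z v
  Reach-mono S⊆S′ here         = here
  Reach-mono S⊆S′ (step p Suv) = step (Reach-mono S⊆S′ p) (S⊆S′ _ _ Suv)

  Reach-first-step : ∀ {v} → Reach S z v → v ≢ z → ∃ λ y → S z y ≡ true × Reach S y v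
  Reach-first-step here v≢z = ⊥-elim (v≢z refl)
  Reach-first-step {v} (step {u} p Suv) v≢z = bool-cases (u == z)
    (λ u≡z → v , subst (λ t → S t v ≡ true) (==⇒≡ u≡z) Suv , here)
    (λ u≢z → let (y , Szy , q) = Reach-first-step p (==false⇒≢ u≢z) in y , Szy , step q Suv)

module OutBranchingProperties {n V A} (arcs-in-V : ∀ u v → A u v ≡ true → (V u ≡ true) × (V v ≡ true))
                              (T : OutBranching n V A) where
  open OutBranching T

  root-parentless : ∀ u → S u root ≢ true
  root-parentless = count≡0⁻ (λ u → S u root) root-indeg

  ≡root⇒parentless : ∀ {v} → v ≡ root → ∀ u → S u v ≢ true
  ≡root⇒parentless refl = root-parentless

  parent-unique : ∀ a b v → S a v ≡ true → S b v ≡ true → a ≡ b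
  parent-unique a b v Sav = count≡1⇒unique (λ u → S u v)
    (indeg-one v (proj₂ (arcs-in-V a v (S⊆A a v Sav)))
               (λ v≡root → ≡root⇒parentless v≡root a Sav)) a b Sav

  parent-exists : ∀ v → V v ≡ true → v ≢ root → ∃ λ u → S u v ≡ true
  parent-exists v Vv v≢root = count≡suc⇒witness (λ u → S u v) (indeg-one v Vv v≢root)

internal-number-transfer : ∀ {n V A V′ A′ k}
  → (∀ (T : OutBranching n V A) → ∃ λ (T′ : OutBranching n V′ A′) → internals T ≤ internals T′)
  → (∀ (T′ : OutBranching n V′ A′) → ∃ λ (T : OutBranching n V A) → internals T′ ≤ internals T)
  → HasInternalNumber n V A k → HasInternalNumber n V′ A′ k
internal-number-transfer {k = k} forward backward ((T , int≡k) , int≤k) =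
  (T′ , ≤-antisym (bounded T′) (subst (_≤ internals T′) int≡k T≤T′)) , bounded
  where
  T′ = proj₁ (forward T)
  T≤T′ = proj₂ (forward T)
  bounded : ∀ T″ → internals T″ ≤ k
  bounded T″ = let (T‴ , T″≤T‴) = backward T″ in ≤-trans T″≤T‴ (int≤k T‴)

delA⁻ : ∀ {n} (A : Fin n → Fin n → Bool) (X : BV n → Bool) u v → delA A X u v ≡ true
  → (A u v ≡ true) × (X (inj₁ u) ≡ false) × (X (inj₁ v) ≡ false)
delA⁻ A X u v p with ∧-true⁻ {A u v} p
... | Auv , q with ∧-true⁻ {not (X (inj₁ u))} q
... | ¬Xu , ¬Xv = Auv , not-true⁻ ¬Xu , not-true⁻ ¬Xv

delA⁺ : ∀ {n} (A : Fin n → Fin n → Bool) (X : BV n → Bool) u v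
  → A u v ≡ true → X (inj₁ u) ≡ false → X (inj₁ v) ≡ false → delA A X u v ≡ true
delA⁺ A X u v Auv ¬Xu ¬Xv rewrite Auv | ¬Xu | ¬Xv = refl

module Reattach {n V A} (arcs-in-V : ∀ u v → A u v ≡ true → (V u ≡ true) × (V v ≡ true))
                (X : BV n → Bool)
                (attach : ∀ v → X (inj₁ v) ≡ true → ∃ λ u → A u v ≡ true × X (inj₁ u) ≡ false)
                (T′ : OutBranching n (delV V X) (delA A X)) where
  open OutBranching T′ renaming (S to S′; root to r′; S⊆A to S′⊆A; root∈V to r′∈V′;
                                 root-indeg to r′-indeg; indeg-one to indeg-one′; spanning to spanning′)

  anchor : Fin n → Fin n
  anchor v = choose (λ u → A u v ∧ not (X (inj₁ u))) v

  anchor-spec : ∀ v → X (inj₁ v) ≡ true → (A (anchor v) v ≡ true) × (X (inj₁ (anchor v)) ≡ false)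
  anchor-spec v Xv with ∧-true⁻ (choose-spec (λ u → A u v ∧ not (X (inj₁ u))) v candidate)
    where candidate = let (u , Auv , ¬Xu) = attach v Xv in u , ∧-true⁺ Auv (not-false⁺ ¬Xu)
  ... | Aav , ¬Xa = Aav , not-true⁻ ¬Xa

  S : Fin n → Fin n → Bool
  S u v = S′ u v ∨ (X (inj₁ v) ∧ (u == anchor v))

  anchor-arc : ∀ v → X (inj₁ v) ≡ true → S (anchor v) v ≡ true
  anchor-arc v Xv = ∨-trueʳ {S′ (anchor v) v} (∧-true⁺ Xv (≡⇒== {a = anchor v} refl))

  S⊆A : ∀ u v → S u v ≡ true → A u v ≡ true
  S⊆A u v p with ∨-true⁻ {S′ u v} p
  ... | inj₁ q = proj₁ (delA⁻ A X u v (S′⊆A u v q))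
  ... | inj₂ q = let (Xv , u≡a) = ∧-true⁻ {X (inj₁ v)} q in
                 subst (λ t → A t v ≡ true) (sym (==⇒≡ u≡a)) (proj₁ (anchor-spec v Xv))

  root-indeg : count (λ u → S u r′) ≡ 0
  root-indeg = count≡0 _ no-parent
    where
    no-parent : ∀ u → S u r′ ≢ true
    no-parent u p with ∨-true⁻ {S′ u r′} p
    ... | inj₁ q = count≡0⁻ _ r′-indeg u q
    ... | inj₂ q = true⇒¬false (proj₁ (∧-true⁻ {X (inj₁ r′)} q))
                               (not-true⁻ (proj₂ (∧-true⁻ {V r′} r′∈V′)))

  indeg-one : ∀ v → V v ≡ true → v ≢ r′ → count (λ u → S u v) ≡ 1
  indeg-one v Vv v≢r′ = bool-cases (X (inj₁ v)) removed kept
    where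
    removed : X (inj₁ v) ≡ true → count (λ u → S u v) ≡ 1
    removed Xv = count≡1 _ (anchor v) (anchor-arc v Xv) unique
      where
      unique : ∀ b → S b v ≡ true → b ≡ anchor v
      unique b p with ∨-true⁻ {S′ b v} p
      ... | inj₁ q = ⊥-elim (true⇒¬false Xv (proj₂ (proj₂ (delA⁻ A X b v (S′⊆A b v q)))))
      ... | inj₂ q = ==⇒≡ (proj₂ (∧-true⁻ {X (inj₁ v)} q))
    kept : X (inj₁ v) ≡ false → count (λ u → S u v) ≡ 1
    kept ¬Xv = count≡1 _ p (∨-trueˡ S′pv) unique
      where
      one = indeg-one′ v (∧-true⁺ Vv (not-false⁺ ¬Xv)) v≢r′
      p = proj₁ (count≡suc⇒witness (λ u → S′ u v) one)
      S′pv = proj₂ (count≡suc⇒witness (λ u → S′ u v) one)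
      unique : ∀ b → S b v ≡ true → b ≡ p
      unique b q with ∨-true⁻ {S′ b v} q
      ... | inj₁ s = count≡1⇒unique _ one b p s S′pv
      ... | inj₂ s = ⊥-elim (true⇒¬false (proj₁ (∧-true⁻ {X (inj₁ v)} s)) ¬Xv)

  spanning : ∀ v → V v ≡ true → Reach S r′ v
  spanning v Vv = bool-cases (X (inj₁ v)) removed
    (λ ¬Xv → Reach-mono (λ _ _ → ∨-trueˡ) (spanning′ v (∧-true⁺ Vv (not-false⁺ ¬Xv))))
    where
    removed : X (inj₁ v) ≡ true → Reach S r′ v
    removed Xv = step (Reach-mono (λ _ _ → ∨-trueˡ) (spanning′ (anchor v) anchor∈V′)) (anchor-arc v Xv)
      where
      anchor∈V′ = ∧-true⁺ (proj₁ (arcs-in-V _ _ (proj₁ (anchor-spec v Xv)))) (not-false⁺ (proj₂ (anchor-spec v Xv)))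

  T : OutBranching n V A
  T = record { S = S ; root = r′ ; S⊆A = S⊆A ; root∈V = proj₁ (∧-true⁻ {V r′} r′∈V′)
             ; root-indeg = root-indeg ; indeg-one = indeg-one ; spanning = spanning }

  internals-≤ : internals T′ ≤ internals T
  internals-≤ = count-≤-injection _ _ _≡_ still-internal (λ i i′ j i≡j i′≡j → trans i≡j (sym i′≡j))
    where
    still-internal : ∀ i → (delV V X i ∧ anyB (S′ i)) ≡ true → ∃ λ j → ((V j ∧ anyB (S j)) ≡ true) × (i ≡ j)
    still-internal i p with ∧-true⁻ {delV V X i} p
    ... | i∈V′ , has-child with anyB-witness (S′ i) has-child
    ... | z , S′iz =
      i , ∧-true⁺ (proj₁ (∧-true⁻ {V i} i∈V′)) (anyB-intro {f = S i} z (∨-trueˡ {S′ i z} S′iz)) , refl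

  reattached : ∃ λ (T : OutBranching n V A) → internals T′ ≤ internals T
  reattached = T , internals-≤

module Crown {n : ℕ} {V : Fin n → Bool} {A : Fin n → Fin n → Bool}
  (arcs-in-V : ∀ u v → A u v ≡ true → (V u ≡ true) × (V v ≡ true))
  (loopless : ∀ v → A v v ≡ false)
  (U : Fin n → Bool) (cover : IsVertexCover V A U)
  (sources-in-U : ∀ v → V v ≡ true → (∀ u → A u v ≡ false) → U v ≡ true)
  (H Cm Cu : BV n → Bool) (crown : IsCrown (inB V A U) (BE V A U) H Cm Cu)
  (C⊆W : ∀ x → (Cm x ∨ Cu x) ≡ true → ∃ λ w → (x ≡ inj₁ w) × (Wset V U w ≡ true))
  where
  open IsCrown crown

  inC : Fin n → Bool
  inC v = Cm (inj₁ v) ∨ Cu (inj₁ v)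

  inC⇒W : ∀ v → inC v ≡ true → Wset V U v ≡ true
  inC⇒W v p with C⊆W (inj₁ v) p
  ... | w , e , Ww = subst (λ t → Wset V U t ≡ true) (sym (inj₁-injective e)) Ww

  W⇒V : ∀ v → Wset V U v ≡ true → V v ≡ true
  W⇒V v p = proj₁ (∧-true⁻ {V v} p)

  W⇒¬U : ∀ v → Wset V U v ≡ true → U v ≡ false
  W⇒¬U v p = not-true⁻ (proj₂ (∧-true⁻ {V v} p))

  U⇒¬inC : ∀ v → U v ≡ true → inC v ≡ false
  U⇒¬inC v Uv = bool-cases (inC v) (λ e → ⊥-elim (true⇒¬false Uv (W⇒¬U v (inC⇒W v e)))) (λ e → e)

  tail∈U : ∀ u v → A u v ≡ true → Wset V U v ≡ true → U u ≡ true
  tail∈U u v Auv Wv with proj₂ cover u v Auv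
  ... | inj₁ Uu = Uu
  ... | inj₂ Uv = ⊥-elim (true⇒¬false Uv (W⇒¬U v Wv))

  head∈U : ∀ u v → A u v ≡ true → Wset V U u ≡ true → U v ≡ true
  head∈U u v Auv Wu with proj₂ cover u v Auv
  ... | inj₁ Uu = ⊥-elim (true⇒¬false Uu (W⇒¬U u Wu))
  ... | inj₂ Uv = Uv

  Cm⇒inC : ∀ v → Cm (inj₁ v) ≡ true → inC v ≡ true
  Cm⇒inC v = ∨-trueˡ

  Cu⇒inC : ∀ v → Cu (inj₁ v) ≡ true → inC v ≡ true
  Cu⇒inC v = ∨-trueʳ

  Cm⇒¬Cu : ∀ v → Cm (inj₁ v) ≡ true → Cu (inj₁ v) ≡ false
  Cm⇒¬Cu v p = bool-cases (Cu (inj₁ v)) (λ e → ⊥-elim (disj-Cm-Cu (inj₁ v) p e)) (λ e → e)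

  ¬inC⇒¬Cu : ∀ v → inC v ≡ false → Cu (inj₁ v) ≡ false
  ¬inC⇒¬Cu v = ∨-conicalʳ (Cm (inj₁ v)) (Cu (inj₁ v))

  U⇒¬Cu : ∀ v → U v ≡ true → Cu (inj₁ v) ≡ false
  U⇒¬Cu v = ¬inC⇒¬Cu v ∘ U⇒¬inC v

  -- The partner of c ∈ Cm is an in-neighbour x of c or a pair xy with x → c → y; entry gives x.
  entry : BV n → Fin n
  entry (inj₁ x)       = x
  entry (inj₂ (x , _)) = x

  data PartnerArcs (v : Fin n) : BV n → Set where
    single : ∀ {x} → U x ≡ true → A x v ≡ true → PartnerArcs v (inj₁ x)
    pair   : ∀ {x y} → U x ≡ true → U y ≡ true → A x v ≡ true → A v y ≡ true → PartnerArcs v (inj₂ (x , y))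

  BE⇒PartnerArcs : ∀ v b → Wset V U v ≡ true → BE V A U (inj₁ v) b → PartnerArcs v b
  BE⇒PartnerArcs v (inj₁ x)       Wv (inj₁ (Uv , _ , _))         = ⊥-elim (true⇒¬false Uv (W⇒¬U v Wv))
  BE⇒PartnerArcs v (inj₁ x)       Wv (inj₂ (Ux , _ , Axv))       = single Ux Axv
  BE⇒PartnerArcs v (inj₂ (x , y)) Wv (inj₂ (Ux , Uy , _ , Axv , Avy)) = pair Ux Uy Axv Avy

  partner-arcs : ∀ v → Cm (inj₁ v) ≡ true → PartnerArcs v (match (inj₁ v))
  partner-arcs v Cmv = BE⇒PartnerArcs v _ (inC⇒W v (Cm⇒inC v Cmv)) (match-E (inj₁ v) Cmv)

  PartnerArcs⇒entry-arc : ∀ {v b} → PartnerArcs v b → (U (entry b) ≡ true) × (A (entry b) v ≡ true)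
  PartnerArcs⇒entry-arc (single Ux Axv)   = Ux , Axv
  PartnerArcs⇒entry-arc (pair Ux _ Axv _) = Ux , Axv

  entry-arc : ∀ v → Cm (inj₁ v) ≡ true
            → (U (entry (match (inj₁ v))) ≡ true) × (A (entry (match (inj₁ v))) v ≡ true)
  entry-arc v Cmv = PartnerArcs⇒entry-arc (partner-arcs v Cmv)

  exit-arc : ∀ v {x y} → Cm (inj₁ v) ≡ true → match (inj₁ v) ≡ inj₂ (x , y) → (U y ≡ true) × (A v y ≡ true)
  exit-arc v Cmv e with subst (PartnerArcs v) e (partner-arcs v Cmv)
  ... | pair _ Uy _ Avy = Uy , Avy

  pair∈H : ∀ w x y → inC w ≡ true → A x w ≡ true → A w y ≡ true → H (inj₂ (x , y)) ≡ true
  pair∈H w x y Cw Axw Awy = N[C]⊆H (inj₂ (x , y)) (Ux , Uy) (inj₁ w , Cw , inj₂ (Ux , Uy , Ww , Axw , Awy))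
    where Ww = inC⇒W w Cw
          Ux = tail∈U x w Axw Ww
          Uy = head∈U w y Awy Ww

  in-neighbour∈H : ∀ x w → inC w ≡ true → A x w ≡ true → H (inj₁ x) ≡ true
  in-neighbour∈H x w Cw Axw =
    N[C]⊆H (inj₁ x) (inj₂ (w , Ww , Axw)) (inj₁ w , Cw , inj₂ (tail∈U x w Axw Ww , Ww , Axw))
    where Ww = inC⇒W w Cw

  partner-of : ∀ h → H h ≡ true → ∃ λ c → (Cm (inj₁ c) ≡ true) × (match (inj₁ c) ≡ h)
  partner-of h Hh with match-surj h Hh
  ... | c , Cmc , e with C⊆W c (∨-trueˡ Cmc)
  ... | w , refl , _ = w , Cmc , e

  inC-has-in-neighbour : ∀ v → inC v ≡ true → ∃ λ u → A u v ≡ true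
  inC-has-in-neighbour v Cv with any? (λ u → A u v ≟ᵇ true)
  ... | yes w  = w
  ... | no ¬w = ⊥-elim (true⇒¬false (sources-in-U v (W⇒V v Wv) (λ u → ¬-not (λ Auv → ¬w (u , Auv)))) (W⇒¬U v Wv))
    where Wv = inC⇒W v Cv

  module Reroute (T : OutBranching n V A) where
    open OutBranching T renaming (root to r)
    open OutBranchingProperties arcs-in-V T

    rootEntry : Fin n
    rootEntry = choose (λ u → A u r) r

    rootEntry-arc : inC r ≡ true → A rootEntry r ≡ true
    rootEntry-arc Cr = choose-spec (λ u → A u r) r (inC-has-in-neighbour r Cr)

    Parent : Fin n → Fin n → Set
    Parent v x = (S x v ≡ true) ⊎ ((v ≡ r) × (x ≡ rootEntry))

    parent? : Fin n → Fin n → Bool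
    parent? v x = S x v ∨ ((v == r) ∧ (x == rootEntry))

    parent?-complete : ∀ v x → Parent v x → parent? v x ≡ true
    parent?-complete v x (inj₁ Sxv)       = ∨-trueˡ Sxv
    parent?-complete v x (inj₂ (e , e′)) = ∨-trueʳ {S x v} (∧-true⁺ (≡⇒== e) (≡⇒== e′))

    parent?-sound : ∀ v x → parent? v x ≡ true → Parent v x
    parent?-sound v x p with ∨-true⁻ {S x v} p
    ... | inj₁ Sxv = inj₁ Sxv
    ... | inj₂ q   = let (e , e′) = ∧-true⁻ {v == r} q in inj₂ (==⇒≡ e , ==⇒≡ e′)

    Parent-unique : ∀ v x x′ → Parent v x → Parent v x′ → x ≡ x′
    Parent-unique v x x′ (inj₁ Sxv)       (inj₁ Sx′v)      = parent-unique x x′ v Sxv Sx′v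
    Parent-unique v x x′ (inj₁ Sxv)       (inj₂ (v≡r , _)) = ⊥-elim (≡root⇒parentless v≡r x Sxv)
    Parent-unique v x x′ (inj₂ (v≡r , _)) (inj₁ Sx′v)      = ⊥-elim (≡root⇒parentless v≡r x′ Sx′v)
    Parent-unique v x x′ (inj₂ (_ , e))   (inj₂ (_ , e′))  = trans e (sym e′)

    Parent-exists : ∀ v → inC v ≡ true → ∃ λ x → Parent v x × (A x v ≡ true)
    Parent-exists v Cv = bool-cases (v == r)
      (λ e → let v≡r = ==⇒≡ e in
             rootEntry , inj₂ (v≡r , refl) ,
             subst (λ t → A rootEntry t ≡ true) (sym v≡r) (rootEntry-arc (subst (λ t → inC t ≡ true) v≡r Cv)))
      (λ e → let (x , Sxv) = parent-exists v (W⇒V v (inC⇒W v Cv)) (==false⇒≢ e) in x , inj₁ Sxv , S⊆A x v Sxv)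

    -- A root r ∈ C is replaced by the partner r′ of (rootEntry, y₀), y₀ being the child of r
    -- on the path of T to rootEntry; the arc r′ → y₀ then makes that path reachable again.
    data NewRoot (r′ : Fin n) : Set where
      keep-root : r′ ≡ r → inC r ≡ false → NewRoot r′
      replace-root : ∀ y₀ → inC r ≡ true → S r y₀ ≡ true → Reach S y₀ rootEntry → Cm (inj₁ r′) ≡ true
                   → match (inj₁ r′) ≡ inj₂ (rootEntry , y₀) → NewRoot r′

    newRoot : ∃ NewRoot
    newRoot = bool-cases (inC r) replace (λ ¬Cr → r , keep-root refl ¬Cr)
      where
      replace : inC r ≡ true → ∃ NewRoot
      replace Cr with Reach-first-step (spanning rootEntry (proj₁ (arcs-in-V _ _ (rootEntry-arc Cr))))
                        (λ e → true⇒¬false (rootEntry-arc Cr) (subst (λ t → A t r ≡ false) (sym e) (loopless r)))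
      ... | y₀ , Sry₀ , y₀⇝rootEntry with partner-of _ (pair∈H r rootEntry y₀ Cr (rootEntry-arc Cr) (S⊆A r y₀ Sry₀))
      ... | c , Cmc , match≡ = c , replace-root y₀ Cr Sry₀ y₀⇝rootEntry Cmc match≡

    module Rerooted (r′ : Fin n) (new-root : NewRoot r′) where

      pairUsed : Fin n → Fin n → Bool
      pairUsed x y = anyB (λ w → inC w ∧ (S w y ∧ parent? w x))

      exitArc : BV n → Fin n → Bool
      exitArc (inj₁ _)       v = false
      exitArc (inj₂ (x , y)) v = (v == y) ∧ pairUsed x y

      S′ : Fin n → Fin n → Bool
      S′ u v = (not (inC u) ∧ (not (inC v) ∧ S u v))
             ∨ (((Cm (inj₁ v) ∧ (u == entry (match (inj₁ v)))) ∧ not (v == r′))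
             ∨ (Cm (inj₁ u) ∧ exitArc (match (inj₁ u)) v))

      data Arc (u v : Fin n) : Set where
        kept     : inC u ≡ false → inC v ≡ false → S u v ≡ true → Arc u v
        entering : Cm (inj₁ v) ≡ true → u ≡ entry (match (inj₁ v)) → v ≢ r′ → Arc u v
        leaving  : ∀ x w → Cm (inj₁ u) ≡ true → match (inj₁ u) ≡ inj₂ (x , v)
                 → inC w ≡ true → S w v ≡ true → Parent w x → Arc u v

      exitArc⇒Arc : ∀ u v b → b ≡ match (inj₁ u) → Cm (inj₁ u) ≡ true → exitArc b v ≡ true → Arc u v
      exitArc⇒Arc u v (inj₂ (x , y)) b≡ Cmu p with ∧-true⁻ {v == y} p
      ... | v≡y , used with anyB-witness _ used
      ... | w , q with ∧-true⁻ {inC w} q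
      ... | Cw , q′ with ∧-true⁻ {S w y} q′
      ... | Swy , par with ==⇒≡ {a = v} v≡y
      ... | refl = leaving x w Cmu (sym b≡) Cw Swy (parent?-sound w x par)

      S′⇒Arc : ∀ u v → S′ u v ≡ true → Arc u v
      S′⇒Arc u v p with ∨-true⁻ {not (inC u) ∧ (not (inC v) ∧ S u v)} p
      ... | inj₁ a with ∧-true⁻ {not (inC u)} a
      ...   | ¬Cu , b with ∧-true⁻ {not (inC v)} b
      ...     | ¬Cv , Suv = kept (not-true⁻ ¬Cu) (not-true⁻ ¬Cv) Suv
      S′⇒Arc u v p | inj₂ q with ∨-true⁻ {(Cm (inj₁ v) ∧ (u == entry (match (inj₁ v)))) ∧ not (v == r′)} q
      ... | inj₁ b with ∧-true⁻ {Cm (inj₁ v) ∧ (u == entry (match (inj₁ v)))} b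
      ...   | b′ , v≢r′ with ∧-true⁻ {Cm (inj₁ v)} b′
      ...     | Cmv , u≡ = entering Cmv (==⇒≡ u≡) (==false⇒≢ (not-true⁻ v≢r′))
      S′⇒Arc u v p | inj₂ q | inj₂ c with ∧-true⁻ {Cm (inj₁ u)} c
      ... | Cmu , e = exitArc⇒Arc u v (match (inj₁ u)) refl Cmu e

      Arc⇒S′ : ∀ u v → Arc u v → S′ u v ≡ true
      Arc⇒S′ u v (kept ¬Cu ¬Cv Suv) rewrite ¬Cu | ¬Cv | Suv = refl
      Arc⇒S′ u v (entering Cmv u≡ v≢r′) = ∨-trueʳ {not (inC u) ∧ (not (inC v) ∧ S u v)}
        (∨-trueˡ (∧-true⁺ (∧-true⁺ Cmv (≡⇒== u≡)) (not-false⁺ (≢⇒==false v≢r′))))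
      Arc⇒S′ u v (leaving x w Cmu match≡ Cw Swv par) = ∨-trueʳ {not (inC u) ∧ (not (inC v) ∧ S u v)}
        (∨-trueʳ {(Cm (inj₁ v) ∧ (u == entry (match (inj₁ v)))) ∧ not (v == r′)}
          (∧-true⁺ Cmu (subst (λ b → exitArc b v ≡ true) (sym match≡)
            (∧-true⁺ (≡⇒== {a = v} refl) (anyB-intro w (∧-true⁺ Cw (∧-true⁺ Swv (parent?-complete w x par))))))))

      S′⇒delA : ∀ u v → S′ u v ≡ true → delA A Cu u v ≡ true
      S′⇒delA u v p with S′⇒Arc u v p
      ... | kept ¬Cu ¬Cv Suv = delA⁺ A Cu u v (S⊆A u v Suv) (¬inC⇒¬Cu u ¬Cu) (¬inC⇒¬Cu v ¬Cv)
      ... | entering Cmv refl _ =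
        let (Uu , Auv) = entry-arc v Cmv in delA⁺ A Cu u v Auv (U⇒¬Cu u Uu) (Cm⇒¬Cu v Cmv)
      ... | leaving x w Cmu match≡ _ _ _ =
        let (Uv , Auv) = exit-arc u Cmu match≡ in delA⁺ A Cu u v Auv (Cm⇒¬Cu u Cmu) (U⇒¬Cu v Uv)

      Cm⇒V′ : ∀ v → Cm (inj₁ v) ≡ true → delV V Cu v ≡ true
      Cm⇒V′ v Cmv = ∧-true⁺ (W⇒V v (inC⇒W v (Cm⇒inC v Cmv))) (not-false⁺ (Cm⇒¬Cu v Cmv))

      child-of-C⇒¬inC : ∀ w v → inC w ≡ true → S w v ≡ true → inC v ≡ false
      child-of-C⇒¬inC w v Cw Swv = U⇒¬inC v (head∈U w v (S⊆A w v Swv) (inC⇒W w Cw))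

      r′∈V′ : delV V Cu r′ ≡ true
      r′∈V′ = from new-root
        where
        from : NewRoot r′ → delV V Cu r′ ≡ true
        from (keep-root r′≡r ¬Cr) =
          subst (λ t → delV V Cu t ≡ true) (sym r′≡r) (∧-true⁺ root∈V (not-false⁺ (¬inC⇒¬Cu r ¬Cr)))
        from (replace-root _ _ _ _ Cmr′ _) = Cm⇒V′ r′ Cmr′

      r′-parentless : ∀ u → S′ u r′ ≢ true
      r′-parentless u p = from (S′⇒Arc u r′ p) new-root
        where
        from : Arc u r′ → NewRoot r′ → ⊥
        from (kept _ _ Sur′)             (keep-root r′≡r _) = ≡root⇒parentless r′≡r u Sur′
        from (kept _ ¬Cr′ _)             (replace-root _ _ _ _ Cmr′ _) = true⇒¬false (Cm⇒inC r′ Cmr′) ¬Cr′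
        from (entering _ _ r′≢r′)        _ = r′≢r′ refl
        from (leaving _ w _ _ _ Swr′ _)  (keep-root r′≡r _) = ≡root⇒parentless r′≡r w Swr′
        from (leaving _ w _ _ Cw Swr′ _) (replace-root _ _ _ _ Cmr′ _) =
          true⇒¬false (Cm⇒inC r′ Cmr′) (child-of-C⇒¬inC w r′ Cw Swr′)

      ¬inC⇒≢r : ∀ v → inC v ≡ false → v ≢ r′ → v ≢ r
      ¬inC⇒≢r v ¬Cv v≢r′ v≡r = from new-root
        where
        from : NewRoot r′ → ⊥
        from (keep-root r′≡r _)           = v≢r′ (trans v≡r (sym r′≡r))
        from (replace-root _ Cr _ _ _ _)  = true⇒¬false (subst (λ t → inC t ≡ true) (sym v≡r) Cr) ¬Cv

      indeg-Cm : ∀ v → Cm (inj₁ v) ≡ true → v ≢ r′ → count (λ u → S′ u v) ≡ 1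
      indeg-Cm v Cmv v≢r′ = count≡1 _ _ (Arc⇒S′ _ v (entering Cmv refl v≢r′)) unique
        where
        unique : ∀ b → S′ b v ≡ true → b ≡ entry (match (inj₁ v))
        unique b p with S′⇒Arc b v p
        ... | kept _ ¬Cv _               = ⊥-elim (true⇒¬false (Cm⇒inC v Cmv) ¬Cv)
        ... | entering _ b≡ _            = b≡
        ... | leaving _ w _ _ Cw Swv _   = ⊥-elim (true⇒¬false (Cm⇒inC v Cmv) (child-of-C⇒¬inC w v Cw Swv))

      indeg-kept : ∀ v p → inC v ≡ false → inC p ≡ false → S p v ≡ true → count (λ u → S′ u v) ≡ 1
      indeg-kept v p ¬Cv ¬Cp Spv = count≡1 _ p (Arc⇒S′ p v (kept ¬Cp ¬Cv Spv)) unique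
        where
        unique : ∀ b → S′ b v ≡ true → b ≡ p
        unique b q with S′⇒Arc b v q
        ... | kept _ _ Sbv             = parent-unique b p v Sbv Spv
        ... | entering Cmv _ _         = ⊥-elim (true⇒¬false (Cm⇒inC v Cmv) ¬Cv)
        ... | leaving _ w _ _ Cw Swv _ =
          ⊥-elim (true⇒¬false (subst (λ t → inC t ≡ true) (parent-unique w p v Swv Spv) Cw) ¬Cp)

      indeg-child-of-C : ∀ v p → inC v ≡ false → inC p ≡ true → S p v ≡ true → count (λ u → S′ u v) ≡ 1
      indeg-child-of-C v p ¬Cv Cp Spv with Parent-exists p Cp
      ... | x , par , Axp with partner-of _ (pair∈H p x v Cp Axp (S⊆A p v Spv))
      ... | c , Cmc , match≡ = count≡1 _ c (Arc⇒S′ c v (leaving x p Cmc match≡ Cp Spv par)) unique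
        where
        unique : ∀ b → S′ b v ≡ true → b ≡ c
        unique b q with S′⇒Arc b v q
        ... | kept ¬Cb _ Sbv   = ⊥-elim (true⇒¬false Cp (subst (λ t → inC t ≡ false) (parent-unique b p v Sbv Spv) ¬Cb))
        ... | entering Cmv _ _ = ⊥-elim (true⇒¬false (Cm⇒inC v Cmv) ¬Cv)
        ... | leaving x′ w Cmb match≡′ _ Swv par′ =
          inj₁-injective (match-inj (inj₁ b) (inj₁ c) Cmb Cmc
            (trans match≡′ (trans (cong (λ t → inj₂ (t , v)) x′≡x) (sym match≡))))
          where
          w≡p = parent-unique w p v Swv Spv
          x′≡x = Parent-unique p x′ x (subst (λ t → Parent t x′) w≡p par′) par

      indeg-one′ : ∀ v → delV V Cu v ≡ true → v ≢ r′ → count (λ u → S′ u v) ≡ 1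
      indeg-one′ v v∈V′ v≢r′ = bool-cases (inC v)
        (λ Cv → indeg-Cm v (∨-true-falseʳ Cv ¬Cuv) v≢r′)
        (λ ¬Cv → let (p , Spv) = parent-exists v (proj₁ (∧-true⁻ {V v} v∈V′)) (¬inC⇒≢r v ¬Cv v≢r′) in
                 bool-cases (inC p) (λ Cp → indeg-child-of-C v p ¬Cv Cp Spv) (λ ¬Cp → indeg-kept v p ¬Cv ¬Cp Spv))
        where ¬Cuv = not-true⁻ (proj₂ (∧-true⁻ {V v} v∈V′))

      Reached : Fin n → Set
      Reached = Reach S′ r′

      Settled : Fin n → Set
      Settled v = (inC v ≡ false → Reached v) × (∀ x → inC v ≡ true → Parent v x → Reached x)

      partner-reached : ∀ x c → Cm (inj₁ c) ≡ true → entry (match (inj₁ c)) ≡ x → Reached x → Reached c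
      partner-reached x c Cmc entry≡x x-reached = bool-cases (c == r′)
        (λ c≡r′ → subst Reached (sym (==⇒≡ c≡r′)) here)
        (λ c≢r′ → step x-reached (Arc⇒S′ x c (entering Cmc (sym entry≡x) (==false⇒≢ c≢r′))))

      child-of-C-reached : ∀ u v → inC u ≡ true → S u v ≡ true → (∀ x → Parent u x → Reached x) → Reached v
      child-of-C-reached u v Cu Suv parents-reached with Parent-exists u Cu
      ... | x , par , Axu with partner-of _ (pair∈H u x v Cu Axu (S⊆A u v Suv))
      ... | c , Cmc , match≡ =
        step (partner-reached x c Cmc (cong entry match≡) (parents-reached x par))
             (Arc⇒S′ c v (leaving x u Cmc match≡ Cu Suv par))

      Settled-step : ∀ u v → Settled u → S u v ≡ true → Settled v
      Settled-step u v (u-reached , parents-reached) Suv = v-reached , parent-reached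
        where
        v-reached : inC v ≡ false → Reached v
        v-reached ¬Cv = bool-cases (inC u)
          (λ Cu → child-of-C-reached u v Cu Suv (λ x → parents-reached x Cu))
          (λ ¬Cu → step (u-reached ¬Cu) (Arc⇒S′ u v (kept ¬Cu ¬Cv Suv)))
        parent-reached : ∀ x → inC v ≡ true → Parent v x → Reached x
        parent-reached x Cv (inj₁ Sxv) = subst Reached (sym (parent-unique x u v Sxv Suv))
          (u-reached (U⇒¬inC u (tail∈U u v (S⊆A u v Suv) (inC⇒W v Cv))))
        parent-reached x Cv (inj₂ (v≡r , _)) = ⊥-elim (≡root⇒parentless v≡r u Suv)

      Settled-root : Settled r
      Settled-root = from new-root
        where
        from : NewRoot r′ → Settled r
        from (keep-root r′≡r ¬Cr) = (λ _ → subst Reached r′≡r here) , (λ _ Cr _ → ⊥-elim (true⇒¬false Cr ¬Cr))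
        from (replace-root y₀ Cr Sry₀ y₀⇝rootEntry Cmr′ match≡) =
          (λ ¬Cr → ⊥-elim (true⇒¬false Cr ¬Cr)) , parent-reached
          where
          y₀-reached : Reached y₀
          y₀-reached = step here (Arc⇒S′ r′ y₀ (leaving rootEntry r Cmr′ match≡ Cr Sry₀ (inj₂ (refl , refl))))
          ¬Cy₀ = child-of-C⇒¬inC r y₀ Cr Sry₀
          rootEntry-settled : Settled rootEntry
          rootEntry-settled = Reach-ind Settled ((λ _ → y₀-reached) , (λ _ Cy₀ _ → ⊥-elim (true⇒¬false Cy₀ ¬Cy₀)))
                                Settled-step y₀⇝rootEntry
          parent-reached : ∀ x → inC r ≡ true → Parent r x → Reached x
          parent-reached x _ (inj₁ Sxr)      = ⊥-elim (root-parentless x Sxr)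
          parent-reached x _ (inj₂ (_ , x≡)) = subst Reached (sym x≡)
            (proj₁ rootEntry-settled (U⇒¬inC rootEntry (tail∈U rootEntry r (rootEntry-arc Cr) (inC⇒W r Cr))))

      settled : ∀ v → V v ≡ true → Settled v
      settled v Vv = Reach-ind Settled Settled-root Settled-step (spanning v Vv)

      spanning′ : ∀ v → delV V Cu v ≡ true → Reached v
      spanning′ v v∈V′ = bool-cases (inC v) in-C (proj₁ (settled v Vv))
        where
        Vv = proj₁ (∧-true⁻ {V v} v∈V′)
        in-C : inC v ≡ true → Reached v
        in-C Cv = partner-reached x v Cmv refl
                    (proj₁ (settled x (proj₁ (arcs-in-V x v Axv))) (U⇒¬inC x Ux))
          where
          Cmv = ∨-true-falseʳ Cv (not-true⁻ (proj₂ (∧-true⁻ {V v} v∈V′)))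
          x = entry (match (inj₁ v))
          Ux = proj₁ (entry-arc v Cmv)
          Axv = proj₂ (entry-arc v Cmv)

      T′ : OutBranching n (delV V Cu) (delA A Cu)
      T′ = record { S = S′ ; root = r′ ; S⊆A = S′⇒delA ; root∈V = r′∈V′
                  ; root-indeg = count≡0 _ r′-parentless
                  ; indeg-one = indeg-one′ ; spanning = spanning′ }

      data Replacement (i : Fin n) : Fin n → Set where
        itself  : inC i ≡ false → Replacement i i
        partner : ∀ {j x y} → Cm (inj₁ j) ≡ true → S i y ≡ true → match (inj₁ j) ≡ inj₂ (x , y)
                → Replacement i j

      Replacement-injective : ∀ i i′ j → Replacement i j → Replacement i′ j → i ≡ i′
      Replacement-injective i .i .i (itself _) (itself _) = refl
      Replacement-injective i i′ .i (itself ¬Ci) (partner Cmi _ _) =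
        ⊥-elim (true⇒¬false (Cm⇒inC i Cmi) ¬Ci)
      Replacement-injective i i′ .i′ (partner Cmi′ _ _) (itself ¬Ci′) =
        ⊥-elim (true⇒¬false (Cm⇒inC i′ Cmi′) ¬Ci′)
      Replacement-injective i i′ j (partner _ Siy match≡) (partner _ Si′y′ match≡′) with trans (sym match≡) match≡′
      ... | refl = parent-unique i i′ _ Siy Si′y′

      Internal′ : Fin n → Set
      Internal′ j = (delV V Cu j ∧ anyB (S′ j)) ≡ true

      internal-outside-C : ∀ i z → V i ≡ true → inC i ≡ false → S i z ≡ true → Internal′ i
      internal-outside-C i z Vi ¬Ci Siz = ∧-true⁺ (∧-true⁺ Vi (not-false⁺ (¬inC⇒¬Cu i ¬Ci))) (bool-cases (inC z) to-C
        (λ ¬Cz → anyB-intro z (Arc⇒S′ i z (kept ¬Ci ¬Cz Siz))))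
        where
        to-C : inC z ≡ true → anyB (S′ i) ≡ true
        to-C Cz with partner-of (inj₁ i) (in-neighbour∈H i z Cz (S⊆A i z Siz))
        ... | c , Cmc , match≡ = anyB-intro c (Arc⇒S′ i c (entering Cmc (sym (cong entry match≡)) c≢r′))
          where
          c≢r′ : c ≢ r′
          c≢r′ c≡r′ = from new-root
            where
            from : NewRoot r′ → ⊥
            from (keep-root r′≡r ¬Cr) =
              true⇒¬false (Cm⇒inC r (subst (λ t → Cm (inj₁ t) ≡ true) (trans c≡r′ r′≡r) Cmc)) ¬Cr
            from (replace-root _ _ _ _ _ match≡′) with trans (sym match≡) (trans (cong (match ∘ inj₁) c≡r′) match≡′)
            ... | ()

      internal-in-C : ∀ i z → inC i ≡ true → S i z ≡ true → ∃ λ j → Internal′ j × Replacement i j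
      internal-in-C i z Ci Siz with Parent-exists i Ci
      ... | x , par , Axi with partner-of _ (pair∈H i x z Ci Axi (S⊆A i z Siz))
      ... | c , Cmc , match≡ =
        c , ∧-true⁺ (Cm⇒V′ c Cmc) (anyB-intro z (Arc⇒S′ c z (leaving x i Cmc match≡ Ci Siz par))) ,
        partner Cmc Siz match≡

      internals-≤ : internals T ≤ internals T′
      internals-≤ = count-≤-injection _ _ Replacement replacement Replacement-injective
        where
        replacement : ∀ i → (V i ∧ anyB (S i)) ≡ true → ∃ λ j → Internal′ j × Replacement i j
        replacement i p with ∧-true⁻ {V i} p
        ... | Vi , has-child with anyB-witness (S i) has-child
        ... | z , Siz = bool-cases (inC i) (λ Ci → internal-in-C i z Ci Siz)
                          (λ ¬Ci → i , internal-outside-C i z Vi ¬Ci Siz , itself ¬Ci)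

    rerouted : ∃ λ (T′ : OutBranching n (delV V Cu) (delA A Cu)) → internals T ≤ internals T′
    rerouted = let open Rerooted (proj₁ newRoot) (proj₂ newRoot) in T′ , internals-≤

  Cu-attachable : ∀ v → Cu (inj₁ v) ≡ true → ∃ λ u → A u v ≡ true × Cu (inj₁ u) ≡ false
  Cu-attachable v Cuv = let (u , Auv) = inC-has-in-neighbour v (Cu⇒inC v Cuv) in
    u , Auv , U⇒¬Cu u (tail∈U u v Auv (inC⇒W v (Cu⇒inC v Cuv)))

lemma3 : (n : ℕ) (V : Fin n → Bool) (A : Fin n → Fin n → Bool)
    → (∀ u v → A u v ≡ true → (V u ≡ true) × (V v ≡ true))
    → (∀ v → A v v ≡ false)
    → OutBranching n V A
    → (U : Fin n → Bool)
    → IsVertexCover V A U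
    → (∀ v → V v ≡ true → (∀ u → A u v ≡ false) → U v ≡ true)
    → (H Cm Cu : BV n → Bool)
    → IsCrown (inB V A U) (BE V A U) H Cm Cu
    → (∀ x → (Cm x ∨ Cu x) ≡ true → ∃ λ w → (x ≡ inj₁ w) × (Wset V U w ≡ true))
    → (∃ λ x → Cu x ≡ true)
    → ∀ k → HasInternalNumber n V A k
    → HasInternalNumber n (delV V Cu) (delA A Cu) k
lemma3 n V A arcs-in-V loopless _ U cover sources-in-U H Cm Cu crown C⊆W _ k =
  internal-number-transfer Reroute.rerouted (Reattach.reattached arcs-in-V Cu Cu-attachable)
  where open Crown arcs-in-V loopless U cover sources-in-U H Cm Cu crown C⊆W
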